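{- Let $E=\mathbf F_3\times\mathbf F_3$ and, for $i\in\mathbf F_3$, let $A_i=\{(x,y)\in E: y=i\}$ and $B_i=\{(x,y)\in E: x=i\}$. Let $T$ be the sparse paving matroid of rank $5$ on $E$ whose circuit-hyperplanes are exactly the eight sets $A_i\cup B_j$ with $(i,j)\neq(0,0)$ (the tic-tac-toe matroid). Then the dual matroid $T^*$ does not satisfy the Ahlswede–Körner property.
   Context: A polymatroid is $(E,f)$ with $E$ finite, $f$ monotone, submodular, $f(\emptyset)=0$; a matroid is a polymatroid with integer-valued $f$ and $f(x)\le1$. A sparse paving matroid of rank $k$ is determined by its circuit-hyperplanes: $k$-subsets pairwise meeting in at most $k-2$ elements; a $k$-set is a basis iff it is not a circuit-hyperplane. The dual of a matroid $(E,f)$ is $(E,f^*)$ with $f^*(X)=|X|-f(E)+f(E\setminus X)$. Notation: $f(X\mid Z)=f(X\cup Z)-f(Z)$. An extension of $(E,f)$ is a polymatroid $(E\cup Z,g)$, $E\cap Z=\emptyset$, with $g|_{\mathcal P(E)}=f$. For $X,Y\subseteq E$, an extension is an Ahlswede–Körner (AK) extension for $(X,Y)$ if $g(Z\mid X)=0$ and $g(X'\mid Z)=g(X'\mid Y)$ for all $X'\subseteq X$. Every polymatroid is $0$-AK; for $k\ge1$ it is $k$-AK if for every pair of subsets of the ground set it admits an AK extension that is $(k-1)$-AK; it satisfies the Ahlswede–Körner property if it is $k$-AK for all $k$.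
   Formalization: The polymatroid extensions $(E\cup Z,g)$ in the definitions of AK extension and k-AK take values in ℚ instead of the reals. -}

module Defs where

open import Data.Nat as ℕ using (ℕ; zero; suc; _⊔_)
open import Data.Integer as ℤ using (ℤ)
open import Data.Rational as ℚ using (ℚ; 0ℚ; _≤_; _+_; _-_)
open import Data.Bool using (Bool; true; false; _∧_; _∨_; not; if_then_else_)
open import Data.Fin as Fin using (Fin; remQuot)
open import Data.Fin.Subset using (Subset; ⊥; ⊤; _∪_; _∩_; _⊆_; ∁; ∣_∣)
open import Data.Vec as Vec using (Vec; []; _∷_; _++_; replicate; tabulate)
open import Data.List as List using (List; []; _∷_; foldr; map)
open import Data.Bool.ListAction using (any)
open import Data.Product using (Σ; _×_; _,_; proj₁; proj₂)
open import Data.Unit using () renaming (⊤ to Unit)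
open import Relation.Binary.PropositionalEquality using (_≡_)
open import Relation.Nullary.Decidable using (⌊_⌋)

record IsPolymatroid (n : ℕ) (f : Subset n → ℚ) : Set where
  field
    normalized : f ⊥ ≡ 0ℚ
    monotone   : ∀ X Y → X ⊆ Y → f X ≤ f Y
    submodular : ∀ X Y → f (X ∪ Y) + f (X ∩ Y) ≤ f X + f Y

-- Ground set of an extension: E ∪ Z = Fin (n + m), E = first n
-- elements, Z = last m elements (so E ∩ Z = ∅).

embed : ∀ {n} m → Subset n → Subset (n ℕ.+ m)
embed m X = X ++ replicate m false

newPart : ∀ n m → Subset (n ℕ.+ m)
newPart n m = replicate n false ++ replicate m true

IsExtension : ∀ {n} m → (Subset n → ℚ) → (Subset (n ℕ.+ m) → ℚ) → Set
IsExtension m f g = ∀ X → g (embed m X) ≡ f X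

cond : ∀ {k} → (Subset k → ℚ) → Subset k → Subset k → ℚ
cond g X Z = g (X ∪ Z) - g Z

IsAKExtension : ∀ {n} m → Subset n → Subset n → (Subset (n ℕ.+ m) → ℚ) → Set
IsAKExtension {n} m X Y g =
  (cond g (newPart n m) (embed m X) ≡ 0ℚ) ×
  (∀ X' → X' ⊆ X →
     cond g (embed m X') (newPart n m) ≡ cond g (embed m X') (embed m Y))

_-AK : ℕ → (n : ℕ) → (Subset n → ℚ) → Set
(zero  -AK) n f = Unit
(suc k -AK) n f = ∀ (X Y : Subset n) →
  Σ ℕ λ m → Σ (Subset (n ℕ.+ m) → ℚ) λ g →
    IsPolymatroid (n ℕ.+ m) g × IsExtension m f g ×
    IsAKExtension m X Y g × (k -AK) (n ℕ.+ m) g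

AKProperty : (n : ℕ) → (Subset n → ℚ) → Set
AKProperty n f = ∀ k → (k -AK) n f

allSubsets : ∀ n → List (Subset n)
allSubsets zero    = [] ∷ []
allSubsets (suc n) =
  map (true ∷_) (allSubsets n) List.++ map (false ∷_) (allSubsets n)

maxList : List ℕ → ℕ
maxList = foldr _⊔_ 0

subsetEq : ∀ {n} → Subset n → Subset n → Bool
subsetEq [] [] = true
subsetEq (a ∷ X) (b ∷ Y) = (a ∧ b ∨ not a ∧ not b) ∧ subsetEq X Y

rankFromBases : ∀ {n} → (Subset n → Bool) → Subset n → ℕ
rankFromBases {n} isBasis X =
  maxList (map (λ B → if isBasis B then ∣ X ∩ B ∣ else 0) (allSubsets n))

sparsePavingRank : ∀ {n} → ℕ → List (Subset n) → Subset n → ℕ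
sparsePavingRank k CH =
  rankFromBases (λ B → ⌊ ∣ B ∣ ℕ.≟ k ⌋ ∧ not (any (subsetEq B) CH))

-- The tic-tac-toe matroid.  E = F₃ × F₃, identified with Fin 9 via the
-- bijection remQuot 3 : Fin (3 * 3) → Fin 3 × Fin 3, e ↦ (x , y).

F₃ : Set
F₃ = Fin 3

coordX coordY : Fin 9 → F₃
coordX e = proj₁ (remQuot {3} 3 e)
coordY e = proj₂ (remQuot {3} 3 e)

A B : F₃ → Subset 9
A i = tabulate λ e → ⌊ coordY e Fin.≟ i ⌋
B i = tabulate λ e → ⌊ coordX e Fin.≟ i ⌋

ticTacToeCH : List (Subset 9)
ticTacToeCH = List.concatMap (λ i → List.concatMap (λ j →
    if ⌊ i Fin.≟ Fin.zero ⌋ ∧ ⌊ j Fin.≟ Fin.zero ⌋ then [] else (A i ∪ B j) ∷ [])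
  (List.allFin 3)) (List.allFin 3)

ticTacToeRank : Subset 9 → ℕ
ticTacToeRank = sparsePavingRank 5 ticTacToeCH

ℕtoℚ : ℕ → ℚ
ℕtoℚ k = ℤ.+ k ℚ./ 1

dualRank : ∀ {n} → (Subset n → ℕ) → Subset n → ℚ
dualRank f X = ℕtoℚ ∣ X ∣ - ℕtoℚ (f ⊤) + ℕtoℚ (f (∁ X))

T* : Subset 9 → ℚ
T* = dualRank ticTacToeRank

{-# OPTIONS --safe #-}
-- T* is the sparse paving matroid of rank 4 whose circuit-hyperplanes are the eight
-- 2×2 grids E ∖ (Aᵢ ∪ Bⱼ), (i , j) ≠ (0 , 0); the remaining grid {1,2} × {1,2} is
-- independent.  Take successive AK sets Z₁ for ((B₁ ∪ B₂) ∖ A₂ , B₀ ∖ A₂),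
-- Z₂ for ((B₁ ∪ B₂) ∖ A₁ , B₀ ∖ A₁) and Z₃ for ((B₀ ∪ B₂) ∖ A₀ , Z₁ ∪ Z₂).
-- The AK identities and submodularity make Z₁ a point of rank 1 on each line Bᵢ ∖ A₂,
-- and Z₂ one on each line Bᵢ ∖ A₁.  Hence Z₁ ∪ Z₂ has rank 2 and each Bᵢ ∪ Z₁ ∪ Z₂
-- rank 3, which turns Z₃ into a set of rank at least 1 on the lines B₀ ∖ A₀ and
-- B₂ ∖ A₀, and then on B₁ ∖ A₀ as well.  But the lines B₁ ∖ A₀ and B₂ ∖ A₀ span
-- the independent grid {1,2} × {1,2}, so Z₃ has rank at most 2 + 2 - 4 = 0.
--
-- Only the blocks Zᵢ as wholes occur, so the argument runs in the pull-back of the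
-- last extension to the twelve points E ∪ {z₁ , z₂ , z₃}.

module Submission where

import Agda.Builtin.FromNat as Literals
open import Algebra.Properties.Group using (x∙y⁻¹≈ε⇒x≈y)
open import Data.Bool using (Bool; true; false; _∨_; _∧_)
import Data.Empty as Empty
import Data.Fin.Literals as Fin
open import Data.Fin.Subset using (Subset; ⊥; _∪_; _∩_; _─_; _⊆_)
open import Data.Fin.Subset.Properties
  using (⊥⊆; ⊆-refl; ⊆-antisym; p⊆p∪q; q⊆p∪q; x∈p∪q⁻; ∪-comm)
open import Data.Nat as ℕ using (ℕ; zero; suc)
import Data.Nat.Literals as ℕ
open import Data.Product using (_,_)
open import Data.Rational using (ℚ; 0ℚ; _≤_; _+_; _-_; -_)
import Data.Rational.Literals as ℚ
import Data.Rational.Properties as ℚ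
open import Data.Rational.Solver using (module +-*-Solver)
open import Data.Sum using ([_,_]′)
open import Data.Unit using (tt)
open import Data.Vec using (_∷_; _++_; replicate; zipWith)
open import Data.Vec.Properties using (zipWith-++; zipWith-replicate)
open import Function using (_∘_; id)
open import Relation.Binary.PropositionalEquality
open import Relation.Nullary using (¬_)

open import Defs

open +-*-Solver using (solve; _:=_; _:+_; _:-_)
open ≡-Reasoning

p+q-q≡p : ∀ p q → p + q - q ≡ p
p+q-q≡p = solve 2 (λ p q → p :+ q :- q := p) refl

p+q≤r⇒p≤r-q : ∀ {p q r} → p + q ≤ r → p ≤ r - q
p+q≤r⇒p≤r-q {p} {q} {r} h = subst (_≤ r - q) (p+q-q≡p p q) (ℚ.+-monoˡ-≤ (- q) h)

p≤q+r⇒p-r≤q : ∀ {p q r} → p ≤ q + r → p - r ≤ q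
p≤q+r⇒p-r≤q {p} {q} {r} h = subst (p - r ≤_) (p+q-q≡p q r) (ℚ.+-monoˡ-≤ (- r) h)

+-−-mono-≤ : ∀ {p p′ q q′ r r′} → p ≤ p′ → q ≤ q′ → r′ ≤ r → p + q - r ≤ p′ + q′ - r′
+-−-mono-≤ p≤p′ q≤q′ r′≤r = ℚ.+-mono-≤ (ℚ.+-mono-≤ p≤p′ q≤q′) (ℚ.neg-antimono-≤ r′≤r)

module Submodular {n} {f : Subset n → ℚ} (P : IsPolymatroid n f) where
  open IsPolymatroid P

  submodular-∪-≤ : ∀ {X Y a b c} → f X ≤ a → f Y ≤ b → c ≤ f (X ∩ Y) →
                   f (X ∪ Y) ≤ a + b - c
  submodular-∪-≤ {X} {Y} fX≤a fY≤b c≤f∩ =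
    ℚ.≤-trans (p+q≤r⇒p≤r-q (submodular X Y)) (+-−-mono-≤ fX≤a fY≤b c≤f∩)

  submodular-∩-≤ : ∀ {X Y a b c} → f X ≤ a → f Y ≤ b → c ≤ f (X ∪ Y) →
                   f (X ∩ Y) ≤ a + b - c
  submodular-∩-≤ {X} {Y} fX≤a fY≤b c≤f∪ =
    ℚ.≤-trans (p+q≤r⇒p≤r-q (subst (_≤ f X + f Y) (ℚ.+-comm (f (X ∪ Y)) (f (X ∩ Y)))
                                  (submodular X Y)))
              (+-−-mono-≤ fX≤a fY≤b c≤f∪)

  submodular-≥ : ∀ {X Y a b c} → a ≤ f (X ∪ Y) → b ≤ f (X ∩ Y) → f Y ≤ c →
                 a + b - c ≤ f X
  submodular-≥ {X} {Y} a≤f∪ b≤f∩ fY≤c =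
    ℚ.≤-trans (+-−-mono-≤ a≤f∪ b≤f∩ fY≤c) (p≤q+r⇒p-r≤q (submodular X Y))

p⊆q⇒p∪q≡q : ∀ {n} {p q : Subset n} → p ⊆ q → p ∪ q ≡ q
p⊆q⇒p∪q≡q {p = p} {q} p⊆q =
  ⊆-antisym (λ x∈p∪q → [ p⊆q , id ]′ (x∈p∪q⁻ p q x∈p∪q)) (q⊆p∪q p q)

⊥-++ : ∀ {n m} → ⊥ {n} ++ ⊥ {m} ≡ ⊥
⊥-++ {zero}  = refl
⊥-++ {suc n} = cong (false ∷_) (⊥-++ {n})

zipWith-++-replicate : ∀ {n m} (f : Bool → Bool → Bool) (X Y : Subset n) a b →
  zipWith f (X ++ replicate m a) (Y ++ replicate m b) ≡ zipWith f X Y ++ replicate m (f a b)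
zipWith-++-replicate f X Y a b =
  trans (zipWith-++ f X _ Y _) (cong (zipWith f X Y ++_) (zipWith-replicate f a b))

record IsSubsetHom {k n} (φ : Subset k → Subset n) : Set where
  field
    ⊥-homo : φ ⊥ ≡ ⊥
    ∪-homo : ∀ X Y → φ (X ∪ Y) ≡ φ X ∪ φ Y
    ∩-homo : ∀ X Y → φ (X ∩ Y) ≡ φ X ∩ φ Y

  mono : ∀ {X Y} → X ⊆ Y → φ X ⊆ φ Y
  mono {X} {Y} X⊆Y =
    subst (φ X ⊆_) (trans (sym (∪-homo X Y)) (cong φ (p⊆q⇒p∪q≡q X⊆Y))) (p⊆p∪q (φ Y))

open IsSubsetHom

IsPolymatroid-comap : ∀ {k n} {φ : Subset k → Subset n} {f : Subset n → ℚ} →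
  IsSubsetHom φ → IsPolymatroid n f → IsPolymatroid k (f ∘ φ)
IsPolymatroid-comap {φ = φ} {f} hom P = record
  { normalized = trans (cong f (⊥-homo hom)) normalized
  ; monotone   = λ X Y X⊆Y → monotone (φ X) (φ Y) (mono hom X⊆Y)
  ; submodular = λ X Y →
      subst₂ (λ U V → f U + f V ≤ f (φ X) + f (φ Y))
             (sym (∪-homo hom X Y)) (sym (∩-homo hom X Y)) (submodular (φ X) (φ Y))
  }
  where open IsPolymatroid P

id-hom : ∀ {n} → IsSubsetHom {n} id
id-hom = record { ⊥-homo = refl ; ∪-homo = λ _ _ → refl ; ∩-homo = λ _ _ → refl }

embed-hom : ∀ {n m} → IsSubsetHom (embed {n} m)
embed-hom {n} {m} = record
  { ⊥-homo = ⊥-++ {n} {m}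
  ; ∪-homo = λ X Y → sym (zipWith-++-replicate _∨_ X Y false false)
  ; ∩-homo = λ X Y → sym (zipWith-++-replicate _∧_ X Y false false)
  }

expand : ∀ {k n} m → (Subset k → Subset n) → Subset (suc k) → Subset (n ℕ.+ m)
expand m φ (a ∷ X) = φ X ++ replicate m a

expand-hom : ∀ {k n m} {φ : Subset k → Subset n} → IsSubsetHom φ → IsSubsetHom (expand m φ)
expand-hom {n = n} {m} {φ} hom = record
  { ⊥-homo = trans (cong (_++ replicate m false) (⊥-homo hom)) (⊥-++ {n} {m})
  ; ∪-homo = λ { (a ∷ X) (b ∷ Y) →
      trans (cong (_++ replicate m (a ∨ b)) (∪-homo hom X Y))
            (sym (zipWith-++-replicate _∨_ (φ X) (φ Y) a b)) }
  ; ∩-homo = λ { (a ∷ X) (b ∷ Y) →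
      trans (cong (_++ replicate m (a ∧ b)) (∩-homo hom X Y))
            (sym (zipWith-++-replicate _∧_ (φ X) (φ Y) a b)) }
  }

newPart-expand : ∀ {k n m} {φ : Subset k → Subset n} → IsSubsetHom φ →
                 newPart n m ≡ expand m φ (true ∷ ⊥)
newPart-expand {m = m} hom = cong (_++ replicate m true) (sym (⊥-homo hom))

record IsAKSet {k n} (h : Subset n → ℚ) (ι : Subset k → Subset n)
               (Z : Subset n) (X : Subset k) (Y : Subset n) : Set where
  constructor mkAKSet
  field
    absorbs : cond h Z (ι X) ≡ 0ℚ
    shift   : ∀ X' → X' ⊆ X → cond h (ι X') Z ≡ cond h (ι X') Y

IsAKExtension⇒IsAKSet : ∀ {n m} {X Y : Subset n} {g} →
  IsAKExtension m X Y g → IsAKSet g (embed m) (newPart n m) X (embed m Y)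
IsAKExtension⇒IsAKSet (absorbs , shift) = mkAKSet absorbs shift

module _ {k n} {h : Subset n → ℚ} {ι : Subset k → Subset n}
         {Z : Subset n} {X : Subset k} {Y : Subset n} (ak : IsAKSet h ι Z X Y) where

  open IsAKSet ak

  AK-absorbs : h (ι X ∪ Z) ≡ h (ι X)
  AK-absorbs = trans (cong h (∪-comm (ι X) Z))
                     (x∙y⁻¹≈ε⇒x≈y ℚ.+-0-group _ _ absorbs)

  AK-∪ : ∀ X' → X' ⊆ X → h (ι X' ∪ Z) ≡ h (ι X) + h (ι X' ∪ Y) - h (ι X ∪ Y)
  AK-∪ X' X'⊆X = begin
    u                      ≡⟨ solve 3 (λ u z t → u := u :- z :- (t :- z) :+ t) refl u z t ⟩
    (u - z) - (t - z) + t  ≡⟨ cong₂ (λ d e → d - e + t) (shift X' X'⊆X) (shift X ⊆-refl) ⟩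
    (a - y) - (b - y) + t  ≡⟨ cong ((a - y) - (b - y) +_) AK-absorbs ⟩
    (a - y) - (b - y) + x  ≡⟨ solve 4 (λ a b y x → a :- y :- (b :- y) :+ x := x :+ a :- b)
                                      refl a b y x ⟩
    x + a - b              ∎
    where u = h (ι X' ∪ Z); z = h Z; t = h (ι X ∪ Z); x = h (ι X)
          a = h (ι X' ∪ Y); b = h (ι X ∪ Y); y = h Y

  AK-rank : ∀ X' → X' ⊆ X → h Z ≡ h (ι X' ∪ Z) + h Y - h (ι X' ∪ Y)
  AK-rank X' X'⊆X = begin
    z              ≡⟨ solve 2 (λ u z → z := u :- (u :- z)) refl u z ⟩
    u - (u - z)    ≡⟨ cong (λ w → u - w) (shift X' X'⊆X) ⟩
    u - (a - y)    ≡⟨ solve 3 (λ u a y → u :- (a :- y) := u :+ y :- a) refl u a y ⟩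
    u + y - a      ∎
    where u = h (ι X' ∪ Z); z = h Z; a = h (ι X' ∪ Y); y = h Y

module _ {k k′ n} {h : Subset n → ℚ} {h′ : Subset k′ → ℚ} {φ : Subset k′ → Subset n}
         (hom : IsSubsetHom φ) (h∘φ≗h′ : ∀ A → h (φ A) ≡ h′ A)
         {ι : Subset k → Subset k′} {Z : Subset k′} {X : Subset k} {Y : Subset k′} where

  private
    cond-comap : ∀ A B → cond h (φ A) (φ B) ≡ cond h′ A B
    cond-comap A B = begin
      h (φ A ∪ φ B) - h (φ B)   ≡⟨ cong (λ U → h U - h (φ B)) (sym (∪-homo hom A B)) ⟩
      h (φ (A ∪ B)) - h (φ B)   ≡⟨ cong₂ _-_ (h∘φ≗h′ (A ∪ B)) (h∘φ≗h′ B) ⟩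
      h′ (A ∪ B) - h′ B         ∎

  IsAKSet-comap : IsAKSet h (φ ∘ ι) (φ Z) X (φ Y) → IsAKSet h′ ι Z X Y
  IsAKSet-comap (mkAKSet absorb shift) = mkAKSet
    (trans (sym (cond-comap _ _)) absorb)
    (λ X' X'⊆X → trans (sym (cond-comap _ _)) (trans (shift X' X'⊆X) (cond-comap _ _)))

  IsAKSet-map : IsAKSet h′ ι Z X Y → IsAKSet h (φ ∘ ι) (φ Z) X (φ Y)
  IsAKSet-map (mkAKSet absorb shift) = mkAKSet
    (trans (cond-comap _ _) absorb)
    (λ X' X'⊆X → trans (cond-comap _ _) (trans (shift X' X'⊆X) (sym (cond-comap _ _))))

IsAKSet-restrict : ∀ {j k n} {h : Subset n → ℚ} {ι : Subset k → Subset n}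
  {ψ : Subset j → Subset k} {Z X Y} → (∀ {A B} → A ⊆ B → ψ A ⊆ ψ B) →
  IsAKSet h ι Z (ψ X) Y → IsAKSet h (ι ∘ ψ) Z X Y
IsAKSet-restrict {ψ = ψ} ψ-mono (mkAKSet absorb shift) =
  mkAKSet absorb (λ X' X'⊆X → shift (ψ X') (ψ-mono X'⊆X))

-- The points are listed as z₃ , z₂ , z₁ followed by E, the order in which
-- `expand` peels them off.
infix 10 ↑_
↑_ : Subset 9 → Subset 12
↑ S = false ∷ false ∷ false ∷ S

ζ₁ ζ₂ ζ₃ : Subset 12
ζ₁ = false ∷ false ∷ true  ∷ ⊥
ζ₂ = false ∷ true  ∷ false ∷ ⊥
ζ₃ = true  ∷ false ∷ false ∷ ⊥

Z₁∪Z₂ : ∀ m₁ m₂ → Subset (9 ℕ.+ m₁ ℕ.+ m₂)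
Z₁∪Z₂ m₁ m₂ = expand m₂ (expand m₁ id) (true ∷ true ∷ ⊥)

module Contraction {m₁ m₂ m₃ : ℕ} {g₁ : Subset (9 ℕ.+ m₁) → ℚ}
  {g₂ : Subset (9 ℕ.+ m₁ ℕ.+ m₂) → ℚ} {h : Subset (9 ℕ.+ m₁ ℕ.+ m₂ ℕ.+ m₃) → ℚ}
  (E₂ : IsExtension m₂ g₁ g₂) (E₃ : IsExtension m₃ g₂ h) where

  Φ₁ : Subset 10 → Subset (9 ℕ.+ m₁)
  Φ₁ = expand m₁ id

  Φ₂ : Subset 11 → Subset (9 ℕ.+ m₁ ℕ.+ m₂)
  Φ₂ = expand m₂ Φ₁

  Φ : Subset 12 → Subset (9 ℕ.+ m₁ ℕ.+ m₂ ℕ.+ m₃)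
  Φ = expand m₃ Φ₂

  Φ₁-hom : IsSubsetHom Φ₁
  Φ₁-hom = expand-hom id-hom

  Φ₂-hom : IsSubsetHom Φ₂
  Φ₂-hom = expand-hom Φ₁-hom

  Φ-hom : IsSubsetHom Φ
  Φ-hom = expand-hom Φ₂-hom

  contract-base : IsExtension m₁ T* g₁ → ∀ S → h (Φ (↑ S)) ≡ T* S
  contract-base E₁ S = trans (E₃ _) (trans (E₂ _) (E₁ S))

  contract₁ : ∀ {X Y} → IsAKExtension m₁ X Y g₁ → IsAKSet (h ∘ Φ) ↑_ ζ₁ X (↑ Y)
  contract₁ ak =
    IsAKSet-comap {h = h} Φ-hom (λ _ → refl)
      (IsAKSet-map {h = h} embed-hom E₃
        (IsAKSet-map {h = g₂} embed-hom E₂ (IsAKExtension⇒IsAKSet ak)))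

  contract₂ : ∀ {X Y} → IsAKExtension m₂ (embed m₁ X) (embed m₁ Y) g₂ →
              IsAKSet (h ∘ Φ) ↑_ ζ₂ X (↑ Y)
  contract₂ {X} {Y} ak =
    IsAKSet-comap {h = h} Φ-hom (λ _ → refl)
      (subst (λ Z → IsAKSet h (Φ ∘ ↑_) Z X (Φ (↑ Y))) (cong (embed m₃) (newPart-expand Φ₁-hom))
        (IsAKSet-map {h = h} embed-hom E₃
          (IsAKSet-restrict (mono embed-hom) (IsAKExtension⇒IsAKSet ak))))

  contract₃ : ∀ {X} → IsAKExtension m₃ (embed m₂ (embed m₁ X)) (Z₁∪Z₂ m₁ m₂) h →
              IsAKSet (h ∘ Φ) ↑_ ζ₃ X (ζ₁ ∪ ζ₂)
  contract₃ {X} ak =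
    IsAKSet-comap {h = h} Φ-hom (λ _ → refl)
      (subst (λ Z → IsAKSet h (Φ ∘ ↑_) Z X (Φ (ζ₁ ∪ ζ₂))) (newPart-expand Φ₂-hom)
        (IsAKSet-restrict (mono embed-hom ∘ mono embed-hom) (IsAKExtension⇒IsAKSet ak)))

-- Literal overloading is confined to this module: elsewhere numerals must stay in ℕ.
module TicTacToe where
  open Literals using (fromNat)

  instance
    ℕ-number = ℕ.number
    F₃-number = Fin.number 3
    ℚ-number = ℚ.number
    unit = tt

  M L N : F₃ → Subset 9
  M i = B i ─ A 2
  L i = B i ─ A 1
  N i = B i ─ A 0

  cell : F₃ → F₃ → Subset 9
  cell i j = B i ∩ A j

  X₁ Y₁ X₂ Y₂ X₃ : Subset 9
  X₁ = M 1 ∪ M 2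
  Y₁ = M 0
  X₂ = L 1 ∪ L 2
  Y₂ = L 0
  X₃ = N 0 ∪ N 2

  -- Every numeral bounding H below is a sum of values of T*, which Agda evaluates.
  module NoThreeAKPoints
    (H : Subset 12 → ℚ) (H-poly : IsPolymatroid 12 H) (H-base : ∀ S → H (↑ S) ≡ T* S)
    (ak₁ : IsAKSet H ↑_ ζ₁ X₁ (↑ Y₁))
    (ak₂ : IsAKSet H ↑_ ζ₂ X₂ (↑ Y₂))
    (ak₃ : IsAKSet H ↑_ ζ₃ X₃ (ζ₁ ∪ ζ₂))
    where

    open IsPolymatroid H-poly using (monotone)
    open Submodular H-poly

    H≤H∪ : ∀ W W′ → H W ≤ H (W ∪ W′)
    H≤H∪ W W′ = monotone W (W ∪ W′) (p⊆p∪q W′)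

    H≤T* : ∀ S → H (↑ S) ≤ T* S
    H≤T* S = ℚ.≤-reflexive (H-base S)

    T*≤H : ∀ S W → T* S ≤ H (↑ S ∪ W)
    T*≤H S W = subst (_≤ H (↑ S ∪ W)) (H-base S) (H≤H∪ (↑ S) W)

    AK-value : ∀ {Z X Y} → IsAKSet H ↑_ Z X (↑ Y) → ∀ X' → X' ⊆ X →
               H (↑ X' ∪ Z) ≡ T* X + T* (X' ∪ Y) - T* (X ∪ Y)
    AK-value ak X' X'⊆X =
      trans (AK-∪ ak X' X'⊆X) (cong₂ _-_ (cong₂ _+_ (H-base _) (H-base _)) (H-base _))

    ζ₁≡1 : H ζ₁ ≡ 1
    ζ₁≡1 = AK-value ak₁ ⊥ ⊥⊆

    M₁ζ₁≤2 : H (↑ M 1 ∪ ζ₁) ≤ 2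
    M₁ζ₁≤2 = ℚ.≤-reflexive (AK-value ak₁ (M 1) (p⊆p∪q (M 2)))

    M₂ζ₁≤2 : H (↑ M 2 ∪ ζ₁) ≤ 2
    M₂ζ₁≤2 = ℚ.≤-reflexive (AK-value ak₁ (M 2) (q⊆p∪q (M 1) (M 2)))

    M₀M₁ζ₁≤3 : H (↑ (M 0 ∪ M 1) ∪ ζ₁) ≤ 3
    M₀M₁ζ₁≤3 = submodular-∪-≤ M₁ζ₁≤2 (H≤T* (M 0 ∪ M 1)) (T*≤H (M 1) ⊥)

    M₀M₂ζ₁≤3 : H (↑ (M 0 ∪ M 2) ∪ ζ₁) ≤ 3
    M₀M₂ζ₁≤3 = submodular-∪-≤ M₂ζ₁≤2 (H≤T* (M 0 ∪ M 2)) (T*≤H (M 2) ⊥)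

    M₀ζ₁≤2 : H (↑ M 0 ∪ ζ₁) ≤ 2
    M₀ζ₁≤2 = submodular-∩-≤ M₀M₁ζ₁≤3 M₀M₂ζ₁≤3 (T*≤H (M 0 ∪ M 1 ∪ M 2) ζ₁)

    c₀₀ζ₁≥2 : 2 ≤ H (↑ cell 0 0 ∪ ζ₁)
    c₀₀ζ₁≥2 = submodular-≥ (T*≤H (cell 0 0 ∪ M 1) ζ₁) (ℚ.≤-reflexive (sym ζ₁≡1)) M₁ζ₁≤2

    c₀₁ζ₁≥2 : 2 ≤ H (↑ cell 0 1 ∪ ζ₁)
    c₀₁ζ₁≥2 = submodular-≥ (T*≤H (cell 0 1 ∪ M 1) ζ₁) (ℚ.≤-reflexive (sym ζ₁≡1)) M₁ζ₁≤2

    B₀ζ₁≤3 : H (↑ B 0 ∪ ζ₁) ≤ 3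
    B₀ζ₁≤3 = submodular-∪-≤ M₀ζ₁≤2 (H≤T* (B 0)) (T*≤H (M 0) ⊥)

    B₁ζ₁≤3 : H (↑ B 1 ∪ ζ₁) ≤ 3
    B₁ζ₁≤3 = submodular-∪-≤ M₁ζ₁≤2 (H≤T* (B 1)) (T*≤H (M 1) ⊥)

    B₂ζ₁≤3 : H (↑ B 2 ∪ ζ₁) ≤ 3
    B₂ζ₁≤3 = submodular-∪-≤ M₂ζ₁≤2 (H≤T* (B 2)) (T*≤H (M 2) ⊥)

    ζ₂≡1 : H ζ₂ ≡ 1
    ζ₂≡1 = AK-value ak₂ ⊥ ⊥⊆

    L₁ζ₂≤2 : H (↑ L 1 ∪ ζ₂) ≤ 2
    L₁ζ₂≤2 = ℚ.≤-reflexive (AK-value ak₂ (L 1) (p⊆p∪q (L 2)))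

    L₂ζ₂≤2 : H (↑ L 2 ∪ ζ₂) ≤ 2
    L₂ζ₂≤2 = ℚ.≤-reflexive (AK-value ak₂ (L 2) (q⊆p∪q (L 1) (L 2)))

    L₀L₁ζ₂≤3 : H (↑ (L 0 ∪ L 1) ∪ ζ₂) ≤ 3
    L₀L₁ζ₂≤3 = submodular-∪-≤ L₁ζ₂≤2 (H≤T* (L 0 ∪ L 1)) (T*≤H (L 1) ⊥)

    L₀L₂ζ₂≤3 : H (↑ (L 0 ∪ L 2) ∪ ζ₂) ≤ 3
    L₀L₂ζ₂≤3 = submodular-∪-≤ L₂ζ₂≤2 (H≤T* (L 0 ∪ L 2)) (T*≤H (L 2) ⊥)

    L₀ζ₂≤2 : H (↑ L 0 ∪ ζ₂) ≤ 2
    L₀ζ₂≤2 = submodular-∩-≤ L₀L₁ζ₂≤3 L₀L₂ζ₂≤3 (T*≤H (L 0 ∪ L 1 ∪ L 2) ζ₂)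

    c₀₀ζ₂≥2 : 2 ≤ H (↑ cell 0 0 ∪ ζ₂)
    c₀₀ζ₂≥2 = submodular-≥ (T*≤H (cell 0 0 ∪ L 1) ζ₂) (ℚ.≤-reflexive (sym ζ₂≡1)) L₁ζ₂≤2

    B₀ζ₂≤3 : H (↑ B 0 ∪ ζ₂) ≤ 3
    B₀ζ₂≤3 = submodular-∪-≤ L₀ζ₂≤2 (H≤T* (B 0)) (T*≤H (L 0) ⊥)

    B₁ζ₂≤3 : H (↑ B 1 ∪ ζ₂) ≤ 3
    B₁ζ₂≤3 = submodular-∪-≤ L₁ζ₂≤2 (H≤T* (B 1)) (T*≤H (L 1) ⊥)

    B₂ζ₂≤3 : H (↑ B 2 ∪ ζ₂) ≤ 3
    B₂ζ₂≤3 = submodular-∪-≤ L₂ζ₂≤2 (H≤T* (B 2)) (T*≤H (L 2) ⊥)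

    B₀ζ₁ζ₂≤3 : H (↑ B 0 ∪ ζ₁ ∪ ζ₂) ≤ 3
    B₀ζ₁ζ₂≤3 = submodular-∪-≤ B₀ζ₁≤3 B₀ζ₂≤3 (T*≤H (B 0) ⊥)

    B₁ζ₁ζ₂≤3 : H (↑ B 1 ∪ ζ₁ ∪ ζ₂) ≤ 3
    B₁ζ₁ζ₂≤3 = submodular-∪-≤ B₁ζ₁≤3 B₁ζ₂≤3 (T*≤H (B 1) ⊥)

    B₂ζ₁ζ₂≤3 : H (↑ B 2 ∪ ζ₁ ∪ ζ₂) ≤ 3
    B₂ζ₁ζ₂≤3 = submodular-∪-≤ B₂ζ₁≤3 B₂ζ₂≤3 (T*≤H (B 2) ⊥)

    M₀ζ₁ζ₂≥3 : 3 ≤ H (↑ M 0 ∪ ζ₁ ∪ ζ₂)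
    M₀ζ₁ζ₂≥3 = submodular-≥ (T*≤H (B 0) (ζ₁ ∪ ζ₂)) c₀₀ζ₂≥2 L₀ζ₂≤2

    c₀₀ζ₁ζ₂≥3 : 3 ≤ H (↑ cell 0 0 ∪ ζ₁ ∪ ζ₂)
    c₀₀ζ₁ζ₂≥3 = submodular-≥ M₀ζ₁ζ₂≥3 c₀₀ζ₁≥2 M₀ζ₁≤2

    ζ₁ζ₂≥2 : 2 ≤ H (ζ₁ ∪ ζ₂)
    ζ₁ζ₂≥2 = submodular-≥ c₀₀ζ₁ζ₂≥3 (T*≤H ⊥ ⊥) (H≤T* (cell 0 0))

    X₃ζ₁ζ₂≥4 : 4 ≤ H (↑ X₃ ∪ ζ₁ ∪ ζ₂)
    X₃ζ₁ζ₂≥4 = ℚ.≤-trans (submodular-≥ (T*≤H (X₃ ∪ M 0) ζ₁) c₀₁ζ₁≥2 M₀ζ₁≤2)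
                         (H≤H∪ (↑ X₃ ∪ ζ₁) ζ₂)

    N₀ζ₁ζ₂≤3 : H (↑ N 0 ∪ ζ₁ ∪ ζ₂) ≤ 3
    N₀ζ₁ζ₂≤3 = ℚ.≤-trans (H≤H∪ (↑ N 0 ∪ ζ₁ ∪ ζ₂) (↑ B 0)) B₀ζ₁ζ₂≤3

    N₂ζ₁ζ₂≤3 : H (↑ N 2 ∪ ζ₁ ∪ ζ₂) ≤ 3
    N₂ζ₁ζ₂≤3 = ℚ.≤-trans (H≤H∪ (↑ N 2 ∪ ζ₁ ∪ ζ₂) (↑ B 2)) B₂ζ₁ζ₂≤3

    ζ₃-on-line : ∀ S → S ⊆ X₃ → H (↑ S ∪ ζ₁ ∪ ζ₂) ≤ 3 → H (↑ S ∪ ζ₃) ≤ 2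
    ζ₃-on-line S S⊆X₃ Sζ₁ζ₂≤3 = ℚ.≤-trans (ℚ.≤-reflexive (AK-∪ ak₃ S S⊆X₃))
                                       (+-−-mono-≤ (H≤T* X₃) Sζ₁ζ₂≤3 X₃ζ₁ζ₂≥4)

    N₀ζ₃≤2 : H (↑ N 0 ∪ ζ₃) ≤ 2
    N₀ζ₃≤2 = ζ₃-on-line (N 0) (p⊆p∪q (N 2)) N₀ζ₁ζ₂≤3

    N₂ζ₃≤2 : H (↑ N 2 ∪ ζ₃) ≤ 2
    N₂ζ₃≤2 = ζ₃-on-line (N 2) (q⊆p∪q (N 0) (N 2)) N₂ζ₁ζ₂≤3

    ζ₃≥1 : 1 ≤ H ζ₃
    ζ₃≥1 = ℚ.≤-trans (+-−-mono-≤ (T*≤H (N 0) ζ₃) ζ₁ζ₂≥2 N₀ζ₁ζ₂≤3)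
                     (ℚ.≤-reflexive (sym (AK-rank ak₃ (N 0) (p⊆p∪q (N 2)))))

    B₀ζ₁ζ₂ζ₃≤3 : H (↑ B 0 ∪ ζ₁ ∪ ζ₂ ∪ ζ₃) ≤ 3
    B₀ζ₁ζ₂ζ₃≤3 = submodular-∪-≤ N₀ζ₃≤2 B₀ζ₁ζ₂≤3 (T*≤H (N 0) ⊥)

    B₂ζ₁ζ₂ζ₃≤3 : H (↑ B 2 ∪ ζ₁ ∪ ζ₂ ∪ ζ₃) ≤ 3
    B₂ζ₁ζ₂ζ₃≤3 = submodular-∪-≤ N₂ζ₃≤2 B₂ζ₁ζ₂≤3 (T*≤H (N 2) ⊥)

    ζ₁ζ₂ζ₃≤2 : H (ζ₁ ∪ ζ₂ ∪ ζ₃) ≤ 2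
    ζ₁ζ₂ζ₃≤2 = submodular-∩-≤ B₀ζ₁ζ₂ζ₃≤3 B₂ζ₁ζ₂ζ₃≤3 (T*≤H (B 0 ∪ B 2) (ζ₁ ∪ ζ₂ ∪ ζ₃))

    B₁ζ₃≤3 : H (↑ B 1 ∪ ζ₃) ≤ 3
    B₁ζ₃≤3 = ℚ.≤-trans (H≤H∪ (↑ B 1 ∪ ζ₃) (ζ₁ ∪ ζ₂))
                       (submodular-∪-≤ B₁ζ₁ζ₂≤3 ζ₁ζ₂ζ₃≤2 ζ₁ζ₂≥2)

    N₀N₁ζ₃≤3 : H (↑ (N 0 ∪ N 1) ∪ ζ₃) ≤ 3
    N₀N₁ζ₃≤3 = submodular-∪-≤ N₀ζ₃≤2 (H≤T* (N 0 ∪ N 1)) (T*≤H (N 0) ⊥)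

    N₁ζ₃≤2 : H (↑ N 1 ∪ ζ₃) ≤ 2
    N₁ζ₃≤2 = submodular-∩-≤ B₁ζ₃≤3 N₀N₁ζ₃≤3 (T*≤H (B 1 ∪ N 0) ζ₃)

    -- N 1 ∪ N 2 is the grid {1,2} × {1,2}, independent in T*.
    ζ₃≤0 : H ζ₃ ≤ 0
    ζ₃≤0 = submodular-∩-≤ N₁ζ₃≤2 N₂ζ₃≤2 (T*≤H (N 1 ∪ N 2) ζ₃)

    -- T (1 ≤ᵇ 0) reduces to Empty.⊥.
    impossible : Empty.⊥
    impossible = ℚ.≤⇒≤ᵇ (ℚ.≤-trans ζ₃≥1 ζ₃≤0)

open TicTacToe

mainTheorem7 : ¬ AKProperty 9 T*
mainTheorem7 ak =
  let m₁ , g₁ , _ , E₁ , ak₁ , 2-AK = ak 3 X₁ Y₁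
      m₂ , g₂ , _ , E₂ , ak₂ , 1-AK = 2-AK (embed m₁ X₂) (embed m₁ Y₂)
      m₃ , h , h-poly , E₃ , ak₃ , _ = 1-AK (embed m₂ (embed m₁ X₃)) (Z₁∪Z₂ m₁ m₂)
      open Contraction {g₁ = g₁} {g₂} {h} E₂ E₃
  in NoThreeAKPoints.impossible (h ∘ Φ) (IsPolymatroid-comap Φ-hom h-poly) (contract-base E₁)
       (contract₁ ak₁) (contract₂ ak₂) (contract₃ ak₃)
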